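{- Let $G$ be a finite simple graph of order $n$ with minimum degree $\delta(G)\geq 2$. Then $$\gamma_{\times 2}(G)+\rho(G)\leq n-\delta(G)+2.$$ Furthermore, this bound is sharp (equality holds for some such graph).
   Context: For a vertex $v$, $N[v]$ is its closed neighbourhood. A set $D\subseteq V(G)$ is a double dominating set if $|N[v]\cap D|\geq 2$ for every $v\in V(G)$; the double domination number $\gamma_{\times 2}(G)$ is the minimum cardinality of a double dominating set. A set $B\subseteq V(G)$ is a packing if $N[u]\cap N[v]=\emptyset$ for all distinct $u,v\in B$; the packing number $\rho(G)$ is the maximum cardinality of a packing. -}

module Defs where

open import Data.Nat using (ℕ; _≤_)
open import Data.Bool using (Bool; false; _∨_)
open import Data.Fin using (Fin; _≟_)
open import Data.Fin.Subset using (Subset; _∩_; ∣_∣; Empty; _∈_)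
open import Data.Vec using (tabulate)
open import Data.Product using (Σ; ∃; _×_)
open import Relation.Nullary using (¬_)
open import Relation.Nullary.Decidable using (⌊_⌋)
open import Relation.Binary.PropositionalEquality using (_≡_)

record SimpleGraph (n : ℕ) : Set where
  field
    Adj    : Fin n → Fin n → Bool
    sym    : ∀ u v → Adj u v ≡ Adj v u
    irrefl : ∀ v → Adj v v ≡ false
open SimpleGraph public

module _ {n : ℕ} (G : SimpleGraph n) where

  N : Fin n → Subset n
  N v = tabulate (λ u → Adj G v u)

  N[_] : Fin n → Subset n
  N[ v ] = tabulate (λ u → ⌊ u ≟ v ⌋ ∨ Adj G v u)

  degree : Fin n → ℕ
  degree v = ∣ N v ∣

  IsMinDegree : ℕ → Set
  IsMinDegree d = (∀ v → d ≤ degree v) × ∃ (λ v → degree v ≡ d)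

  IsDoubleDominating : Subset n → Set
  IsDoubleDominating D = ∀ v → 2 ≤ ∣ N[ v ] ∩ D ∣

  IsDoubleDomNumber : ℕ → Set
  IsDoubleDomNumber k =
    Σ (Subset n) (λ D → IsDoubleDominating D × ∣ D ∣ ≡ k)
    × (∀ D → IsDoubleDominating D → k ≤ ∣ D ∣)

  IsPacking : Subset n → Set
  IsPacking B = ∀ u v → u ∈ B → v ∈ B → ¬ (u ≡ v) → Empty (N[ u ] ∩ N[ v ])

  IsPackingNumber : ℕ → Set
  IsPackingNumber p =
    Σ (Subset n) (λ B → IsPacking B × ∣ B ∣ ≡ p)
    × (∀ B → IsPacking B → ∣ B ∣ ≤ p)

module Submission where

-- Let B be a maximum packing and δ = e + 2. Every closed neighbourhood N[v] meets B at
-- most once, so after enlarging B by any e further vertices to a set S, N[v] still meets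
-- S at most e + 1 times, while |N[v]| ≥ δ + 1 = e + 3. Hence the complement of S is a
-- double dominating set, and γ×2 ≤ n − |S| = n − ρ − δ + 2. If fewer than e vertices lie
-- outside B, the complement of S would be empty, which no double dominating set is.
-- Equality holds for complete graphs, where γ×2 = 2, ρ = 1 and δ = n − 1.

open import Defs hiding (sym)
open import Data.Nat using (ℕ; zero; suc; _+_; _∸_; _≤_; z≤n; s≤s)
open import Data.Nat.Properties
  using (suc-injective; ≤-refl; ≤-trans; ≤-reflexive; m≤n⇒m≤1+n; +-suc; +-comm; +-assoc;
         +-monoʳ-≤; +-monoˡ-≤; ≤-antisym; +-cancelʳ-≤; m+n∸n≡m; m∸n+n≡m; n∸n≡0; module ≤-Reasoning)
open import Data.Bool using (Bool; true; false; not; _∨_)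
open import Data.Bool.Properties using (∨-inverseʳ)
open import Data.Fin using (Fin; _≟_) renaming (zero to fzero; suc to fsuc)
open import Data.Fin.Properties using () renaming (suc-injective to fsuc-injective)
open import Data.Fin.Subset using (Subset; inside; outside; _∩_; ∁; ⊤; ⊥; ⁅_⁆; ∣_∣; Empty; _∈_)
open import Data.Fin.Subset.Properties
  using (p∩q⊆p; p∩q⊆q; x∈p∩q⁺; ∣p∩q∣≤∣q∣; ∣∁p∣≡n∸∣p∣; ∣p∣≤n; ∣⊤∣≡n; ∣⊥∣≡0; Empty-unique;
         p⊆q⇒∣p∣≤∣q∣; ∣⁅x⁆∣≡1; x∈⁅y⁆⇒x≡y)
open import Data.Vec using ([]; _∷_; tabulate; here; there)
open import Data.Vec.Properties using (lookup∘tabulate; tabulate-cong; []=⇒lookup; lookup⇒[]=)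
open import Data.Product using (Σ; _×_; _,_)
open import Data.Sum using (_⊎_; inj₁; inj₂)
import Data.Sum as Sum
open import Data.Empty using (⊥-elim)
open import Relation.Nullary using (yes; no)
open import Relation.Nullary.Decidable using (⌊_⌋; ⌊⌋-map′)
open import Relation.Binary.PropositionalEquality
  using (_≡_; refl; sym; trans; cong; cong₂; subst; ≡-≟-identity; ≢-≟-identity)

⌊≟⌋-refl : ∀ {n} (v : Fin n) → ⌊ v ≟ v ⌋ ≡ true
⌊≟⌋-refl v = cong ⌊_⌋ (≡-≟-identity _≟_ refl)

⌊≟⌋-sym : ∀ {n} (u v : Fin n) → ⌊ u ≟ v ⌋ ≡ ⌊ v ≟ u ⌋
⌊≟⌋-sym u v with u ≟ v
... | yes u≡v = sym (cong ⌊_⌋ (≡-≟-identity _≟_ (sym u≡v)))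
... | no  u≢v = sym (cong ⌊_⌋ (≢-≟-identity _≟_ (λ v≡u → u≢v (sym v≡u))))

∈-tabulate⁺ : ∀ {n} (f : Fin n → Bool) {u : Fin n} → f u ≡ true → u ∈ tabulate f
∈-tabulate⁺ f {u} fu≡true = lookup⇒[]= u (tabulate f) (trans (lookup∘tabulate f u) fu≡true)

∈-tabulate⁻ : ∀ {n} (f : Fin n → Bool) {u : Fin n} → u ∈ tabulate f → f u ≡ true
∈-tabulate⁻ f {u} u∈f = trans (sym (lookup∘tabulate f u)) ([]=⇒lookup u∈f)

∣p∣≡∣p∩q∣+∣p∩∁q∣ : ∀ {n} (p q : Subset n) → ∣ p ∣ ≡ ∣ p ∩ q ∣ + ∣ p ∩ ∁ q ∣
∣p∣≡∣p∩q∣+∣p∩∁q∣ []            []            = refl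
∣p∣≡∣p∩q∣+∣p∩∁q∣ (outside ∷ p) (_       ∷ q) = ∣p∣≡∣p∩q∣+∣p∩∁q∣ p q
∣p∣≡∣p∩q∣+∣p∩∁q∣ (inside  ∷ p) (inside  ∷ q) = cong suc (∣p∣≡∣p∩q∣+∣p∩∁q∣ p q)
∣p∣≡∣p∩q∣+∣p∩∁q∣ (inside  ∷ p) (outside ∷ q) =
  trans (cong suc (∣p∣≡∣p∩q∣+∣p∩∁q∣ p q)) (sym (+-suc _ _))

∣∁p∣+∣p∣≡n : ∀ {n} (p : Subset n) → ∣ ∁ p ∣ + ∣ p ∣ ≡ n
∣∁p∣+∣p∣≡n p = trans (cong (_+ ∣ p ∣) (∣∁p∣≡n∸∣p∣ p)) (m∸n+n≡m (∣p∣≤n p))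

∣∁⊤∣≡0 : ∀ n → ∣ ∁ (⊤ {n}) ∣ ≡ 0
∣∁⊤∣≡0 n = trans (∣∁p∣≡n∸∣p∣ (⊤ {n})) (trans (cong (n ∸_) (∣⊤∣≡n n)) (n∸n≡0 n))

unique⇒∣p∣≤1 : ∀ {n} (p : Subset n) → (∀ {x y} → x ∈ p → y ∈ p → x ≡ y) → ∣ p ∣ ≤ 1
unique⇒∣p∣≤1 []            _      = z≤n
unique⇒∣p∣≤1 (outside ∷ p) unique =
  unique⇒∣p∣≤1 p (λ x∈p y∈p → fsuc-injective (unique (there x∈p) (there y∈p)))
unique⇒∣p∣≤1 {suc n} (inside ∷ p) unique =
  s≤s (≤-reflexive (trans (cong ∣_∣ (Empty-unique p-empty)) (∣⊥∣≡0 n)))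
  where
  p-empty : Empty p
  p-empty (x , x∈p) with () ← unique here (there x∈p)

∣x∷p∣≡suc∣x∷q∣ : ∀ {n} x {p q : Subset n} → ∣ p ∣ ≡ suc ∣ q ∣ → ∣ x ∷ p ∣ ≡ suc ∣ x ∷ q ∣
∣x∷p∣≡suc∣x∷q∣ inside  eq = cong suc eq
∣x∷p∣≡suc∣x∷q∣ outside eq = eq

∣tabulate-≟∨∣ : ∀ {n} (w : Fin n) (g : Fin n → Bool) → g w ≡ false →
                ∣ tabulate (λ u → ⌊ u ≟ w ⌋ ∨ g u) ∣ ≡ suc ∣ tabulate g ∣
∣tabulate-≟∨∣ fzero    g gw≡false rewrite gw≡false = refl
∣tabulate-≟∨∣ (fsuc w) g gw≡false =
  ∣x∷p∣≡suc∣x∷q∣ (g fzero) {tail⁺} {tail}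
    (trans tail⁺-shift (∣tabulate-≟∨∣ w (λ u → g (fsuc u)) gw≡false))
  where
  tail⁺ tail : Subset _
  tail⁺ = tabulate (λ u → ⌊ fsuc u ≟ fsuc w ⌋ ∨ g (fsuc u))
  tail  = tabulate (λ u → g (fsuc u))
  tail⁺-shift : ∣ tail⁺ ∣ ≡ ∣ tabulate (λ u → ⌊ u ≟ w ⌋ ∨ g (fsuc u)) ∣
  tail⁺-shift = cong ∣_∣ (tabulate-cong (λ u → cong (_∨ g (fsuc u)) (⌊⌋-map′ _ _ (u ≟ w))))

-- Adds the first m elements outside q; when fewer exist, the result is ⊤.
extend : ∀ {n} → ℕ → Subset n → Subset n
extend zero    q             = q
extend (suc m) []            = []
extend (suc m) (inside  ∷ q) = inside ∷ extend (suc m) q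
extend (suc m) (outside ∷ q) = inside ∷ extend m q

∣p∩extend∣≤m+∣p∩q∣ : ∀ {n} m (p q : Subset n) → ∣ p ∩ extend m q ∣ ≤ m + ∣ p ∩ q ∣
∣p∩extend∣≤m+∣p∩q∣ zero    p             q             = ≤-refl
∣p∩extend∣≤m+∣p∩q∣ (suc m) []            []            = z≤n
∣p∩extend∣≤m+∣p∩q∣ (suc m) (outside ∷ p) (inside  ∷ q) = ∣p∩extend∣≤m+∣p∩q∣ (suc m) p q
∣p∩extend∣≤m+∣p∩q∣ (suc m) (outside ∷ p) (outside ∷ q) = m≤n⇒m≤1+n (∣p∩extend∣≤m+∣p∩q∣ m p q)
∣p∩extend∣≤m+∣p∩q∣ (suc m) (inside  ∷ p) (outside ∷ q) = s≤s (∣p∩extend∣≤m+∣p∩q∣ m p q)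
∣p∩extend∣≤m+∣p∩q∣ (suc m) (inside  ∷ p) (inside  ∷ q) =
  ≤-trans (s≤s (∣p∩extend∣≤m+∣p∩q∣ (suc m) p q)) (≤-reflexive (sym (+-suc (suc m) _)))

∣extend∣≡m+∣q∣⊎extend≡⊤ : ∀ {n} m (q : Subset n) → ∣ extend m q ∣ ≡ m + ∣ q ∣ ⊎ extend m q ≡ ⊤
∣extend∣≡m+∣q∣⊎extend≡⊤ zero    q             = inj₁ refl
∣extend∣≡m+∣q∣⊎extend≡⊤ (suc m) []            = inj₂ refl
∣extend∣≡m+∣q∣⊎extend≡⊤ (suc m) (inside  ∷ q) =
  Sum.map (λ eq → trans (cong suc eq) (sym (+-suc (suc m) ∣ q ∣))) (cong (inside ∷_))
          (∣extend∣≡m+∣q∣⊎extend≡⊤ (suc m) q)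
∣extend∣≡m+∣q∣⊎extend≡⊤ (suc m) (outside ∷ q) =
  Sum.map (cong suc) (cong (inside ∷_)) (∣extend∣≡m+∣q∣⊎extend≡⊤ m q)

module _ {n : ℕ} (G : SimpleGraph n) where

  ∈N[]-sym : ∀ {u w} → u ∈ N[_] G w → w ∈ N[_] G u
  ∈N[]-sym {u} {w} u∈N[w] = ∈-tabulate⁺ _ (trans closed-adj-sym (∈-tabulate⁻ _ u∈N[w]))
    where
    closed-adj-sym : ⌊ w ≟ u ⌋ ∨ Adj G u w ≡ ⌊ u ≟ w ⌋ ∨ Adj G w u
    closed-adj-sym = cong₂ _∨_ (⌊≟⌋-sym w u) (SimpleGraph.sym G u w)

  ∣N[v]∣≡1+degree : ∀ v → ∣ N[_] G v ∣ ≡ suc (degree G v)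
  ∣N[v]∣≡1+degree v = ∣tabulate-≟∨∣ v (Adj G v) (irrefl G v)

  packing⇒∣N[v]∩B∣≤1 : ∀ {B} → IsPacking G B → ∀ v → ∣ N[_] G v ∩ B ∣ ≤ 1
  packing⇒∣N[v]∩B∣≤1 {B} packing v = unique⇒∣p∣≤1 (N[_] G v ∩ B) unique
    where
    unique : ∀ {x y} → x ∈ N[_] G v ∩ B → y ∈ N[_] G v ∩ B → x ≡ y
    unique {x} {y} x∈ y∈ with x ≟ y
    ... | yes x≡y = x≡y
    ... | no  x≢y = ⊥-elim (packing x y (p∩q⊆q _ _ x∈) (p∩q⊆q _ _ y∈) x≢y
                      (v , x∈p∩q⁺ (∈N[]-sym (p∩q⊆p _ _ x∈) , ∈N[]-sym (p∩q⊆p _ _ y∈))))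

  doubleDominating⇒2≤∣D∣ : ∀ {D} → Fin n → IsDoubleDominating G D → 2 ≤ ∣ D ∣
  doubleDominating⇒2≤∣D∣ {D} v dd = ≤-trans (dd v) (∣p∩q∣≤∣q∣ (N[_] G v) D)

  ∁extend-doubleDominating : ∀ {e B} → (∀ v → 2 + e ≤ degree G v) → IsPacking G B →
                             IsDoubleDominating G (∁ (extend e B))
  ∁extend-doubleDominating {e} {B} δ≥2+e packing v = +-cancelʳ-≤ _ 2 _ (begin
    2 + ∣ N[v] ∩ S ∣                 ≤⟨ +-monoʳ-≤ 2 ∣N[v]∩S∣≤e+1 ⟩
    2 + (e + 1)                      ≡⟨ cong (2 +_) (+-comm e 1) ⟩
    suc (2 + e)                      ≤⟨ s≤s (δ≥2+e v) ⟩
    suc (degree G v)                 ≡⟨ sym (∣N[v]∣≡1+degree v) ⟩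
    ∣ N[v] ∣                         ≡⟨ ∣p∣≡∣p∩q∣+∣p∩∁q∣ N[v] S ⟩
    ∣ N[v] ∩ S ∣ + ∣ N[v] ∩ ∁ S ∣   ≡⟨ +-comm ∣ N[v] ∩ S ∣ _ ⟩
    ∣ N[v] ∩ ∁ S ∣ + ∣ N[v] ∩ S ∣   ∎)
    where
    open ≤-Reasoning
    S N[v] : Subset n
    S    = extend e B
    N[v] = N[_] G v
    ∣N[v]∩S∣≤e+1 : ∣ N[v] ∩ S ∣ ≤ e + 1
    ∣N[v]∩S∣≤e+1 = ≤-trans (∣p∩extend∣≤m+∣p∩q∣ e N[v] B) (+-monoʳ-≤ e (packing⇒∣N[v]∩B∣≤1 packing v))

k≤x⇒k+p≤x+[e+p]∸[2+e]+2 : ∀ {k x} e p → k ≤ x → 2 ≤ x → k + p ≤ x + (e + p) ∸ (2 + e) + 2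
k≤x⇒k+p≤x+[e+p]∸[2+e]+2 {k} e p k≤x (s≤s (s≤s {n = y} _)) = begin
  k + p                 ≤⟨ +-monoˡ-≤ p k≤x ⟩
  2 + (y + p)           ≡⟨ +-comm 2 (y + p) ⟩
  y + p + 2             ≡⟨ cong (_+ 2) (sym (m+n∸n≡m (y + p) e)) ⟩
  y + p + e ∸ e + 2     ≡⟨ cong (λ m → m ∸ e + 2) (+-assoc y p e) ⟩
  y + (p + e) ∸ e + 2   ≡⟨ cong (λ m → y + m ∸ e + 2) (+-comm p e) ⟩
  y + (e + p) ∸ e + 2   ∎
  where open ≤-Reasoning

γ×2+ρ≤n∸δ+2 : ∀ {n} (G : SimpleGraph n) {d k p} → IsMinDegree G d → 2 ≤ d →
              IsDoubleDomNumber G k → IsPackingNumber G p → k + p ≤ n ∸ d + 2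
γ×2+ρ≤n∸δ+2 {n} G {k = k} (δ≥d , v , _) (s≤s (s≤s {n = e} _))
             (_ , γ×2-minimal) ((B , packing , refl) , _) =
  bound (∣extend∣≡m+∣q∣⊎extend≡⊤ e B)
  where
  S D : Subset n
  S = extend e B
  D = ∁ S
  D-dd : IsDoubleDominating G D
  D-dd = ∁extend-doubleDominating G δ≥d packing
  2≤∣D∣ : 2 ≤ ∣ D ∣
  2≤∣D∣ = doubleDominating⇒2≤∣D∣ G v D-dd
  bound : ∣ S ∣ ≡ e + ∣ B ∣ ⊎ S ≡ ⊤ → k + ∣ B ∣ ≤ n ∸ (2 + e) + 2
  bound (inj₁ ∣S∣≡e+p) = subst (λ m → k + ∣ B ∣ ≤ m ∸ (2 + e) + 2) ∣D∣+e+p≡n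
    (k≤x⇒k+p≤x+[e+p]∸[2+e]+2 e ∣ B ∣ (γ×2-minimal D D-dd) 2≤∣D∣)
    where
    ∣D∣+e+p≡n : ∣ D ∣ + (e + ∣ B ∣) ≡ n
    ∣D∣+e+p≡n = trans (cong (∣ D ∣ +_) (sym ∣S∣≡e+p)) (∣∁p∣+∣p∣≡n S)
  bound (inj₂ S≡⊤) with () ← subst (2 ≤_) (∣∁⊤∣≡0 n) (subst (λ X → 2 ≤ ∣ ∁ X ∣) S≡⊤ 2≤∣D∣)

complete : ∀ n → SimpleGraph n
complete n = record
  { Adj    = λ u v → not ⌊ u ≟ v ⌋
  ; sym    = λ u v → cong not (⌊≟⌋-sym u v)
  ; irrefl = λ v → cong not (⌊≟⌋-refl v)
  }

module _ {n : ℕ} where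

  complete-∈N[] : ∀ (u v : Fin n) → u ∈ N[_] (complete n) v
  complete-∈N[] u v =
    ∈-tabulate⁺ _ (trans (cong (λ b → ⌊ u ≟ v ⌋ ∨ not b) (⌊≟⌋-sym v u)) (∨-inverseʳ ⌊ u ≟ v ⌋))

  complete-degree : ∀ v → suc (degree (complete n) v) ≡ n
  complete-degree v = trans (sym (∣N[v]∣≡1+degree (complete n) v)) (≤-antisym (∣p∣≤n N[v]) n≤∣N[v]∣)
    where
    N[v] : Subset n
    N[v] = N[_] (complete n) v
    n≤∣N[v]∣ : n ≤ ∣ N[v] ∣
    n≤∣N[v]∣ = ≤-trans (≤-reflexive (sym (∣⊤∣≡n n))) (p⊆q⇒∣p∣≤∣q∣ {p = ⊤} (λ {u} _ → complete-∈N[] u v))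

  complete-packing⇒∣B∣≤1 : ∀ {B} → IsPacking (complete n) B → ∣ B ∣ ≤ 1
  complete-packing⇒∣B∣≤1 {B} packing = unique⇒∣p∣≤1 B unique
    where
    unique : ∀ {x y} → x ∈ B → y ∈ B → x ≡ y
    unique {x} {y} x∈B y∈B with x ≟ y
    ... | yes x≡y = x≡y
    ... | no  x≢y = ⊥-elim (packing x y x∈B y∈B x≢y
                      (x , x∈p∩q⁺ (complete-∈N[] x x , complete-∈N[] x y)))

complete-minDegree : ∀ m → IsMinDegree (complete (suc m)) m
complete-minDegree m = (λ v → ≤-reflexive (sym (degree≡m v))) , fzero , degree≡m fzero
  where
  degree≡m : ∀ v → degree (complete (suc m)) v ≡ m
  degree≡m v = suc-injective (complete-degree v)

complete-doubleDomNumber : ∀ m → IsDoubleDomNumber (complete (2 + m)) 2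
complete-doubleDomNumber m =
  (D , D-dd , cong (2 +_) (∣⊥∣≡0 m)) , λ D′ → doubleDominating⇒2≤∣D∣ (complete (2 + m)) {D′} fzero
  where
  D : Subset (2 + m)
  D = inside ∷ inside ∷ ⊥
  D-dd : IsDoubleDominating (complete (2 + m)) D
  D-dd v = ≤-trans (≤-reflexive (cong (2 +_) (sym (∣⊥∣≡0 m))))
                   (p⊆q⇒∣p∣≤∣q∣ (λ {u} u∈D → x∈p∩q⁺ (complete-∈N[] u v , u∈D)))

complete-packingNumber : ∀ m → IsPackingNumber (complete (suc m)) 1
complete-packingNumber m =
  (⁅ fzero ⁆ , singleton-packing , ∣⁅x⁆∣≡1 (fzero {m})) , λ B → complete-packing⇒∣B∣≤1
  where
  singleton-packing : IsPacking (complete (suc m)) ⁅ fzero ⁆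
  singleton-packing u v u∈ v∈ u≢v =
    ⊥-elim (u≢v (trans (x∈⁅y⁆⇒x≡y fzero u∈) (sym (x∈⁅y⁆⇒x≡y fzero v∈))))

theorem4 : ((n : ℕ) (G : SimpleGraph n) (d k p : ℕ)
             → IsMinDegree G d → 2 ≤ d
             → IsDoubleDomNumber G k → IsPackingNumber G p
             → k + p ≤ n ∸ d + 2)
           × Σ ℕ (λ n → Σ (SimpleGraph n) (λ G → Σ ℕ (λ d → Σ ℕ (λ k → Σ ℕ (λ p →
               IsMinDegree G d × 2 ≤ d × IsDoubleDomNumber G k × IsPackingNumber G p
               × k + p ≡ n ∸ d + 2)))))
theorem4 = (λ n G d k p → γ×2+ρ≤n∸δ+2 G)
         , 3 , complete 3 , 2 , 2 , 1
         , complete-minDegree 2 , s≤s (s≤s z≤n) , complete-doubleDomNumber 1 , complete-packingNumber 2 , refl
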